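{- For every finite shape $S$ in the triangular lattice $\mathbb T$, the $C_2$-scaling $\Lambda_{C_2}(S)$ of $S$ admits a Hamiltonian cycle, i.e. there is a cycle in $\mathbb T$ visiting every point of $\Lambda_{C_2}(S)$ exactly once and using only points of $\Lambda_{C_2}(S)$.
   Context: Triangular lattice: $\mathbb T=(\mathbb Z^2,\sim)$ with $(x,y)\sim(u,v)$ iff $(u,v)-(x,y)\in\{\pm(1,0),\pm(0,1),\pm(1,1)\}$. A shape is a connected set of points of $\mathbb T$. With $H'_2=\{(i,j):-2<i\le2,-2<j\le2,-2\le i-j<2\}$, $\Lambda_{C_2}(S)=\bigcup_{(i,j)\in S}\big(i(2,-2)+j(2,4)+H'_2\big)$. -}

module Defs where

open import Data.Integer using (ℤ; +_; -_; _+_; _-_; _*_; _≤_; _<_)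
open import Data.Product using (_×_; _,_; ∃; ∃-syntax; Σ)
open import Data.Sum using (_⊎_)
open import Data.Nat as ℕ using (ℕ)
open import Data.List using (List; []; _∷_; length; head; last)
open import Data.List.Membership.Propositional using (_∈_)
open import Data.List.Relation.Unary.All using (All)
open import Data.List.Relation.Unary.Unique.Propositional using (Unique)
open import Data.Maybe using (just)
open import Relation.Binary.PropositionalEquality using (_≡_)

-- Points of the triangular lattice 𝕋 (vertex set ℤ²)
Point : Set
Point = ℤ × ℤ

data Step : ℤ → ℤ → Set where
  r  : Step (+ 1) (+ 0)
  l  : Step (- (+ 1)) (+ 0)
  u  : Step (+ 0) (+ 1)
  d  : Step (+ 0) (- (+ 1))
  ur : Step (+ 1) (+ 1)
  dl : Step (- (+ 1)) (- (+ 1))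

_∼_ : Point → Point → Set
(x , y) ∼ (a , b) = Step (a - x) (b - y)

data Chain : List Point → Set where
  []  : Chain []
  [_] : ∀ p → Chain (p ∷ [])
  _∷_ : ∀ {p q ps} → p ∼ q → Chain (q ∷ ps) → Chain (p ∷ q ∷ ps)

-- finite sets of points are given by lists (membership _∈_)
-- Connectedness of a (finite) set of points: any two points are joined
-- by a walk in 𝕋 staying inside the set
Connected : List Point → Set
Connected S = ∀ {a b} → a ∈ S → b ∈ S →
  ∃[ w ] (Chain w × All (_∈ S) w × head w ≡ just a × last w ≡ just b)

record FiniteShape : Set where
  field
    pts       : List Point
    nonempty  : ∃[ p ] (p ∈ pts)
    connected : Connected pts

InH2 : Point → Set
InH2 (i , j) = (- (+ 2) < i × i ≤ + 2) × (- (+ 2) < j × j ≤ + 2)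
             × (- (+ 2) ≤ i - j × i - j < + 2)

InΛC2 : List Point → Point → Set
InΛC2 S (x , y) = ∃[ i ] ∃[ j ] ((i , j) ∈ S ×
  InH2 (x - (i * + 2 + j * + 2) , y - (i * - (+ 2) + j * + 4)))

HamiltonianCycle : (Point → Set) → List Point → Set
HamiltonianCycle P c =
  3 ℕ.≤ length c × Unique c × Chain c
  × (∀ {a b} → last c ≡ just a → head c ≡ just b → a ∼ b)
  × All P c × (∀ p → P p → p ∈ c)

-- H'₂ has twelve points, and it is a transversal of the sublattice spanned by (2,-2) and
-- (2,4), so Λ_{C₂}(S) is the disjoint union of the translates ("tiles") of H'₂ indexed by S.
-- H'₂ carries a Hamiltonian cycle, and for each of the six lattice directions it has a
-- "door": an edge of that cycle which, together with the opposite door of the neighbouring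
-- tile, spans a 4-cycle of 𝕋.  Starting from one tile and walking through the connected
-- shape S, each tile reached for the first time is absorbed by replacing the door edge of
-- its predecessor with the Hamiltonian path of the new tile that starts and ends at its
-- opposite door.  Doors facing tiles not yet absorbed stay edges of the growing cycle, so
-- the construction can always proceed.
module Submission where

open import Defs
open import Data.Product using (∃-syntax)

open import Data.Empty using (⊥-elim)
open import Data.Integer as ℤ using (ℤ; +_; -[1+_]; _+_; _-_; _*_; -_)
import Data.Integer.Properties as ℤ
open import Data.Integer.Divisibility.Signed using (_∣_; divides; _∣?_)
open import Data.Integer.Tactic.RingSolver using (solve-∀)
open import Data.List using (List; []; _∷_; _++_; map; length; head; last)
import Data.List.Properties as List
open import Data.List.Membership.Propositional using (_∈_; _∉_)
open import Data.List.Membership.Propositional.Properties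
  using (∈-map⁺; ∈-map⁻; ∈-++⁺ˡ; ∈-++⁺ʳ; ∈-++⁻)
open import Data.List.Relation.Binary.Disjoint.Propositional using (Disjoint)
open import Data.List.Relation.Binary.Permutation.Propositional
  using (_↭_; ↭-sym; ↭-trans; ↭-reflexive; ↭⇒↭ₛ)
open import Data.List.Relation.Binary.Permutation.Propositional.Properties
  using (shift; shifts; ++-comm; ++⁺ˡ; ∈-resp-↭; ↭-length)
import Data.List.Relation.Binary.Permutation.Setoid.Properties as Permutationₛ
open import Data.List.Relation.Binary.Subset.Propositional using (_⊆_)
open import Data.List.Relation.Binary.Subset.Propositional.Properties using (⊆-refl; ⊆-trans)
open import Data.List.Relation.Unary.All as All using (All; []; _∷_)
open import Data.List.Relation.Unary.Any using (here; there)
open import Data.List.Relation.Unary.Unique.Propositional using (Unique)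
import Data.List.Relation.Unary.Unique.Propositional.Properties as Unique
open import Data.Maybe as Maybe using (Maybe; just; nothing)
open import Data.Maybe.Properties using (just-injective)
open import Data.Nat as ℕ using (z≤n; s≤s)
import Data.Nat.Properties as ℕ
open import Data.Product using (_×_; _,_; proj₁; proj₂; ∃₂)
import Data.Product.Properties as Product
open import Data.Sum using (_⊎_; inj₁; inj₂; [_,_]′)
import Data.Sum as Sum
open import Function using (_∘_)
open import Relation.Binary.PropositionalEquality
  using (_≡_; _≢_; refl; sym; trans; cong; cong₂; subst; subst₂; setoid)
open import Relation.Nullary using (Dec; yes; no)
open import Relation.Nullary.Decidable using (from-yes; _→-dec_; _×-dec_)

Consecutive : {A : Set} → A → A → List A → Set
Consecutive a b xs = ∃[ us ] ∃[ vs ] xs ≡ us ++ a ∷ b ∷ vs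

module _ {A : Set} where

  consecutive⇒∈ : ∀ {a b : A} {xs} → Consecutive a b xs → a ∈ xs
  consecutive⇒∈ (us , _ , refl) = ∈-++⁺ʳ us (here refl)

  consecutive-++ˡ : ∀ {a b : A} {xs} ys → Consecutive a b xs → Consecutive a b (xs ++ ys)
  consecutive-++ˡ {a} {b} ys (us , vs , refl) = us , vs ++ ys , List.++-assoc us (a ∷ b ∷ vs) ys

  consecutive-++ʳ : ∀ {a b : A} {ys} xs → Consecutive a b ys → Consecutive a b (xs ++ ys)
  consecutive-++ʳ {a} {b} xs (us , vs , refl) = xs ++ us , vs , sym (List.++-assoc xs us (a ∷ b ∷ vs))

  consecutive-map : ∀ {B : Set} (f : A → B) {a b xs} →
                    Consecutive a b xs → Consecutive (f a) (f b) (map f xs)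
  consecutive-map f {a} {b} (us , vs , refl) = map f us , map f vs , List.map-++ f us (a ∷ b ∷ vs)

  consecutive-split : ∀ (xs : List A) {a b ys p q} → Consecutive p q (xs ++ a ∷ b ∷ ys) → p ≢ a →
                      Consecutive p q (xs ++ a ∷ []) ⊎ Consecutive p q (b ∷ ys)
  consecutive-split []            ([] , _ , refl)      p≢a = ⊥-elim (p≢a refl)
  consecutive-split []            (_ ∷ us , vs , eq)   _   = inj₂ (us , vs , List.∷-injectiveʳ eq)
  consecutive-split (_ ∷ [])      ([] , _ , refl)      _   = inj₁ ([] , [] , refl)
  consecutive-split (_ ∷ _ ∷ xs) {a} ([] , _ , refl)  _   = inj₁ ([] , xs ++ a ∷ [] , refl)
  consecutive-split (x ∷ xs)      (_ ∷ us , vs , eq)   p≢a =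
    Sum.map₁ (consecutive-++ʳ (x ∷ [])) (consecutive-split xs (us , vs , List.∷-injectiveʳ eq) p≢a)

  last-++ : ∀ (xs : List A) {y} ys → last (xs ++ y ∷ ys) ≡ last (y ∷ ys)
  last-++ []           _  = refl
  last-++ (_ ∷ [])     _  = refl
  last-++ (_ ∷ x ∷ xs) ys = last-++ (x ∷ xs) ys

  head-++ : ∀ (xs : List A) {y} ys zs → head (xs ++ y ∷ ys) ≡ head (xs ++ y ∷ zs)
  head-++ []      _ _ = refl
  head-++ (_ ∷ _) _ _ = refl

  ∈-last : ∀ {xs} {x : A} → last xs ≡ just x → x ∈ xs
  ∈-last {_ ∷ []}     refl = here refl
  ∈-last {_ ∷ _ ∷ _} eq   = there (∈-last eq)

  unique-resp-↭ : ∀ {xs ys : List A} → xs ↭ ys → Unique xs → Unique ys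
  unique-resp-↭ p = Permutationₛ.Unique-resp-↭ (setoid A) (↭⇒↭ₛ p)

  splice-↭ : ∀ (xs : List A) {a} ds zs → xs ++ a ∷ ds ++ zs ↭ ds ++ xs ++ a ∷ zs
  splice-↭ xs {a} ds zs = ↭-trans (++⁺ˡ xs (↭-sym (shift a ds zs))) (shifts xs ds)

  ∈-splice⁻ : ∀ (xs : List A) {a ds zs v} →
              v ∈ xs ++ a ∷ ds ++ zs → v ∈ ds ⊎ v ∈ xs ++ a ∷ zs
  ∈-splice⁻ xs {ds = ds} {zs} v∈ = ∈-++⁻ ds (∈-resp-↭ (splice-↭ xs ds zs) v∈)

  ∈-splice⁺ˡ : ∀ (xs : List A) {a ds zs v} → v ∈ ds → v ∈ xs ++ a ∷ ds ++ zs
  ∈-splice⁺ˡ xs {ds = ds} {zs} v∈ = ∈-resp-↭ (↭-sym (splice-↭ xs ds zs)) (∈-++⁺ˡ v∈)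

  ∈-splice⁺ʳ : ∀ (xs : List A) {a ds zs v} → v ∈ xs ++ a ∷ zs → v ∈ xs ++ a ∷ ds ++ zs
  ∈-splice⁺ʳ xs {ds = ds} {zs} v∈ = ∈-resp-↭ (↭-sym (splice-↭ xs ds zs)) (∈-++⁺ʳ ds v∈)

  unique-splice : ∀ (xs : List A) {a ds zs} → Unique ds → Unique (xs ++ a ∷ zs) →
                  Disjoint ds (xs ++ a ∷ zs) → Unique (xs ++ a ∷ ds ++ zs)
  unique-splice xs {ds = ds} {zs} ds! xs! disjoint =
    unique-resp-↭ (↭-sym (splice-↭ xs ds zs)) (Unique.++⁺ ds! xs! disjoint)

  length-splice : ∀ (xs : List A) {a} ds zs → length (xs ++ a ∷ zs) ℕ.≤ length (xs ++ a ∷ ds ++ zs)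
  length-splice xs ds zs = subst (_ ℕ.≤_) (sym (↭-length (splice-↭ xs ds zs)))
    (subst (_ ℕ.≤_) (sym (List.length-++ ds)) (ℕ.m≤n+m _ (length ds)))

  consecutive-splice : ∀ (xs : List A) {a b ys p q} ds →
                       Consecutive p q (xs ++ a ∷ b ∷ ys) → p ≢ a →
                       Consecutive p q (xs ++ a ∷ ds ++ b ∷ ys)
  consecutive-splice xs {a} {b} {ys} ds pq p≢a = [ before , after ]′ (consecutive-split xs pq p≢a)
    where
    before : ∀ {p q} → Consecutive p q (xs ++ a ∷ []) → Consecutive p q (xs ++ a ∷ ds ++ b ∷ ys)
    before e = subst (Consecutive _ _) (List.++-assoc xs (a ∷ []) (ds ++ b ∷ ys))
                     (consecutive-++ˡ (ds ++ b ∷ ys) e)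
    after : ∀ {p q} → Consecutive p q (b ∷ ys) → Consecutive p q (xs ++ a ∷ ds ++ b ∷ ys)
    after e = subst (Consecutive _ _) (List.++-assoc xs (a ∷ ds) (b ∷ ys))
                    (consecutive-++ʳ (xs ++ a ∷ ds) e)

  consecutive-spliced : ∀ (xs : List A) {a b ys p q ds} →
                        Consecutive p q ds → Consecutive p q (xs ++ a ∷ ds ++ b ∷ ys)
  consecutive-spliced xs {a} {b} {ys} e =
    consecutive-++ʳ xs (consecutive-++ʳ (a ∷ []) (consecutive-++ˡ (b ∷ ys) e))

  cut : ∀ {a b : A} {xs} → Consecutive a b xs → List A
  cut {a} {b} (us , vs , _) = b ∷ vs ++ us ++ a ∷ []

  cut-↭ : ∀ {a b : A} {xs} (e : Consecutive a b xs) → cut e ↭ xs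
  cut-↭ {a} {b} (us , vs , refl) =
    ↭-trans (++-comm (b ∷ vs) (us ++ a ∷ [])) (↭-reflexive (List.++-assoc us (a ∷ []) (b ∷ vs)))

  last-cut : ∀ {a b : A} {xs} (e : Consecutive a b xs) → last (cut e) ≡ just a
  last-cut {a} {b} (us , vs , _) =
    trans (cong last (sym (List.++-assoc (b ∷ vs) us (a ∷ [])))) (last-++ (b ∷ vs ++ us) [])

  consecutive-cut : ∀ {a b p q : A} {xs} (e : Consecutive a b xs) → Consecutive p q xs → p ≢ a →
                    Consecutive p q (cut e)
  consecutive-cut {a} {b} (us , vs , refl) pq p≢a =
    [ consecutive-++ʳ (b ∷ vs) , consecutive-++ˡ (us ++ a ∷ []) ]′ (consecutive-split us pq p≢a)

Joinable : List Point → List Point → Set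
Joinable xs ys = ∀ {x y} → last xs ≡ just x → head ys ≡ just y → x ∼ y

chain-tail : ∀ {x xs} → Chain (x ∷ xs) → Chain xs
chain-tail [ _ ]   = []
chain-tail (_ ∷ c) = c

chain-++⁻ʳ : ∀ xs {ys} → Chain (xs ++ ys) → Chain ys
chain-++⁻ʳ []       c = c
chain-++⁻ʳ (_ ∷ xs) c = chain-++⁻ʳ xs (chain-tail c)

chain-prefix : ∀ xs {a ys} → Chain (xs ++ a ∷ ys) → Chain (xs ++ a ∷ [])
chain-prefix []           _         = [ _ ]
chain-prefix (_ ∷ [])     (st ∷ _)  = st ∷ [ _ ]
chain-prefix (_ ∷ x ∷ xs) (st ∷ c)  = st ∷ chain-prefix (x ∷ xs) c

chain-++⁺ : ∀ {xs ys} → Chain xs → Chain ys → Joinable xs ys → Chain (xs ++ ys)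
chain-++⁺ []        cy        _ = cy
chain-++⁺ [ _ ]     []        _ = [ _ ]
chain-++⁺ [ _ ]     [ y ]     j = j refl refl ∷ [ y ]
chain-++⁺ [ _ ]     (st ∷ cy) j = j refl refl ∷ st ∷ cy
chain-++⁺ (st ∷ cx) cy        j = st ∷ chain-++⁺ cx cy j

chain-splice : ∀ xs {a b ys ds} → Chain (xs ++ a ∷ b ∷ ys) →
               Chain (a ∷ ds) → Joinable (a ∷ ds) (b ∷ ys) → Chain (xs ++ a ∷ ds ++ b ∷ ys)
chain-splice []           (_ ∷ c)  cd j = chain-++⁺ cd c j
chain-splice (_ ∷ [])     (st ∷ c) cd j = st ∷ chain-splice [] c cd j
chain-splice (_ ∷ x ∷ xs) (st ∷ c) cd j = st ∷ chain-splice (x ∷ xs) c cd j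

chain-cut : ∀ {a b xs} (e : Consecutive a b xs) → Chain xs → Joinable xs xs → Chain (cut e)
chain-cut (us , vs , refl) c closed =
  chain-++⁺ (chain-tail (chain-++⁻ʳ us c)) (chain-prefix us c)
    (λ ex ey → closed (trans (last-++ us _) ex) (trans (sym (head-++ us [] _)) ey))

infixl 6 _⊕_ _⊖_

_⊕_ : Point → Point → Point
(a , b) ⊕ (c , e) = a + c , b + e

_⊖_ : Point → Point → Point
(a , b) ⊖ (c , e) = a - c , b - e

⊕-assoc : ∀ p q r → p ⊕ q ⊕ r ≡ p ⊕ (q ⊕ r)
⊕-assoc (p₁ , p₂) (q₁ , q₂) (r₁ , r₂) =
  cong₂ _,_ (ℤ.+-assoc p₁ q₁ r₁) (ℤ.+-assoc p₂ q₂ r₂)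

⊕-comm : ∀ p q → p ⊕ q ≡ q ⊕ p
⊕-comm (p₁ , p₂) (q₁ , q₂) = cong₂ _,_ (ℤ.+-comm p₁ q₁) (ℤ.+-comm p₂ q₂)

⊕-identityʳ : ∀ p → p ⊕ (+ 0 , + 0) ≡ p
⊕-identityʳ (p₁ , p₂) = cong₂ _,_ (ℤ.+-identityʳ p₁) (ℤ.+-identityʳ p₂)

[m⊕n]⊖m≡n : ∀ m n → m ⊕ n ⊖ m ≡ n
[m⊕n]⊖m≡n (m₁ , m₂) (n₁ , n₂) = cong₂ _,_ (lemma m₁ n₁) (lemma m₂ n₂)
  where
  lemma : ∀ m n → m + n - m ≡ n
  lemma = solve-∀

m⊕[n⊖m]≡n : ∀ m n → m ⊕ (n ⊖ m) ≡ n
m⊕[n⊖m]≡n (m₁ , m₂) (n₁ , n₂) = cong₂ _,_ (lemma m₁ n₁) (lemma m₂ n₂)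
  where
  lemma : ∀ m n → m + (n - m) ≡ n
  lemma = solve-∀

⊕-cancelˡ : ∀ v {p q} → v ⊕ p ≡ v ⊕ q → p ≡ q
⊕-cancelˡ v {p} {q} eq = trans (sym ([m⊕n]⊖m≡n v p)) (trans (cong (_⊖ v) eq) ([m⊕n]⊖m≡n v q))

⊕-cancelʳ : ∀ v {p q} → p ⊕ v ≡ q ⊕ v → p ≡ q
⊕-cancelʳ v {p} {q} eq = ⊕-cancelˡ v (trans (⊕-comm v p) (trans eq (⊕-comm q v)))

⊕-≡⇒⊖-≡ : ∀ a b p q → a ⊕ p ≡ b ⊕ q → q ⊖ p ≡ a ⊖ b
⊕-≡⇒⊖-≡ (a₁ , a₂) (b₁ , b₂) (p₁ , p₂) (q₁ , q₂) eq =
  cong₂ _,_ (lemma a₁ b₁ p₁ q₁ (cong proj₁ eq)) (lemma a₂ b₂ p₂ q₂ (cong proj₂ eq))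
  where
  lemma : ∀ a b p q → a + p ≡ b + q → q - p ≡ a - b
  lemma a b p q e =
    trans (regroup b q p) (trans (cong (λ z → z - b - p) (sym e)) (cancel a p b))
    where
    regroup : ∀ b q p → q - p ≡ b + q - b - p
    regroup = solve-∀
    cancel : ∀ a p b → a + p - b - p ≡ a - b
    cancel = solve-∀

translate-∼ : ∀ v {p q} → p ∼ q → (v ⊕ p) ∼ (v ⊕ q)
translate-∼ (v₁ , v₂) {p₁ , p₂} {q₁ , q₂} =
  subst₂ Step (sym (lemma v₁ p₁ q₁)) (sym (lemma v₂ p₂ q₂))
  where
  lemma : ∀ v p q → v + q - (v + p) ≡ q - p
  lemma = solve-∀

chain-translate : ∀ v {xs} → Chain xs → Chain (map (v ⊕_) xs)
chain-translate v []       = []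
chain-translate v [ p ]    = [ v ⊕ p ]
chain-translate v (st ∷ c) = translate-∼ v st ∷ chain-translate v c

tileOrigin : Point → Point
tileOrigin (i , j) = i * + 2 + j * + 2 , i * - (+ 2) + j * + 4

tileOrigin-⊕ : ∀ s t → tileOrigin (s ⊕ t) ≡ tileOrigin s ⊕ tileOrigin t
tileOrigin-⊕ (i , j) (k , m) = cong₂ _,_ (lemma₁ i j k m) (lemma₂ i j k m)
  where
  lemma₁ : ∀ i j k m → (i + k) * + 2 + (j + m) * + 2 ≡ i * + 2 + j * + 2 + (k * + 2 + m * + 2)
  lemma₁ = solve-∀
  lemma₂ : ∀ i j k m → (i + k) * - (+ 2) + (j + m) * + 4
                      ≡ i * - (+ 2) + j * + 4 + (k * - (+ 2) + m * + 4)
  lemma₂ = solve-∀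

tileOrigin-⊖ : ∀ s t → tileOrigin (s ⊖ t) ≡ tileOrigin s ⊖ tileOrigin t
tileOrigin-⊖ (i , j) (k , m) = cong₂ _,_ (lemma₁ i j k m) (lemma₂ i j k m)
  where
  lemma₁ : ∀ i j k m → (i - k) * + 2 + (j - m) * + 2 ≡ i * + 2 + j * + 2 - (k * + 2 + m * + 2)
  lemma₁ = solve-∀
  lemma₂ : ∀ i j k m → (i - k) * - (+ 2) + (j - m) * + 4
                      ≡ i * - (+ 2) + j * + 4 - (k * - (+ 2) + m * + 4)
  lemma₂ = solve-∀

tileOrigin-injective : ∀ {s t} → tileOrigin s ≡ tileOrigin t → s ≡ t
tileOrigin-injective {i , j} {k , m} eq = cong₂ _,_ i≡k j≡m
  where
  sum : ∀ i j → i * + 2 + j * + 2 + (i * - (+ 2) + j * + 4) ≡ j * + 6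
  sum = solve-∀
  j≡m : j ≡ m
  j≡m = ℤ.*-cancelʳ-≡ j m (+ 6)
    (trans (sym (sum i j)) (trans (cong₂ _+_ (cong proj₁ eq) (cong proj₂ eq)) (sum k m)))
  first : ∀ i j → i * + 2 + j * + 2 - j * + 2 ≡ i * + 2
  first = solve-∀
  i≡k : i ≡ k
  i≡k = ℤ.*-cancelʳ-≡ i k (+ 2)
    (trans (sym (first i j)) (trans (cong₂ (λ x y → x - y * + 2) (cong proj₁ eq) j≡m) (first k m)))

-- The sublattice of index 12 spanned by (2,-2) and (2,4).
InSublattice : Point → Set
InSublattice (x , y) = + 2 ∣ x × + 6 ∣ x + y

tileOrigin-inSublattice : ∀ t → InSublattice (tileOrigin t)
tileOrigin-inSublattice (i , j) = divides (i + j) (first i j) , divides j (sum i j)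
  where
  first : ∀ i j → i * + 2 + j * + 2 ≡ (i + j) * + 2
  first = solve-∀
  sum : ∀ i j → i * + 2 + j * + 2 + (i * - (+ 2) + j * + 4) ≡ j * + 6
  sum = solve-∀

-- The hexagon H'₂ and its doors

data Direction : Set where
  R L U D UR DL : Direction

direction : Direction → Point
direction R  = + 1 , + 0
direction L  = -[1+ 0 ] , + 0
direction U  = + 0 , + 1
direction D  = + 0 , -[1+ 0 ]
direction UR = + 1 , + 1
direction DL = -[1+ 0 ] , -[1+ 0 ]

opposite : Direction → Direction
opposite R  = L
opposite L  = R
opposite U  = D
opposite D  = U
opposite UR = DL
opposite DL = UR

direction-opposite : ∀ δ → direction δ ⊕ direction (opposite δ) ≡ (+ 0 , + 0)
direction-opposite R  = refl
direction-opposite L  = refl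
direction-opposite U  = refl
direction-opposite D  = refl
direction-opposite UR = refl
direction-opposite DL = refl

⊕-direction-opposite : ∀ t δ → t ⊕ direction δ ⊕ direction (opposite δ) ≡ t
⊕-direction-opposite t δ =
  trans (⊕-assoc t _ _) (trans (cong (t ⊕_) (direction-opposite δ)) (⊕-identityʳ t))

step-direction : ∀ {dx dy} → Step dx dy → ∃[ δ ] direction δ ≡ (dx , dy)
step-direction r  = R , refl
step-direction l  = L , refl
step-direction u  = U , refl
step-direction d  = D , refl
step-direction ur = UR , refl
step-direction dl = DL , refl

∼⇒direction : ∀ {p q} → p ∼ q → ∃[ δ ] q ≡ p ⊕ direction δ
∼⇒direction {p₁ , p₂} {q} st with step-direction st
... | δ , eq = δ , trans (sym (m⊕[n⊖m]≡n (p₁ , p₂) q)) (cong ((p₁ , p₂) ⊕_) (sym eq))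

hexagon : List Point
hexagon = (+ 0 , + 1) ∷ (+ 0 , + 0) ∷ (+ 1 , + 1) ∷ (+ 1 , + 2) ∷ (+ 2 , + 2) ∷ (+ 2 , + 1)
        ∷ (+ 1 , + 0) ∷ (+ 0 , -[1+ 0 ]) ∷ (-[1+ 0 ] , -[1+ 0 ]) ∷ (-[1+ 0 ] , + 0)
        ∷ (-[1+ 0 ] , + 1) ∷ (+ 0 , + 2) ∷ []

hexagon-chain : Chain hexagon
hexagon-chain = d ∷ ur ∷ u ∷ r ∷ d ∷ dl ∷ dl ∷ l ∷ u ∷ u ∷ ur ∷ [ _ ]

hexagon-closed : Joinable hexagon hexagon
hexagon-closed refl refl = d

exit entry : Direction → Point
exit R  = + 2 , + 1
exit L  = -[1+ 0 ] , + 1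
exit U  = + 1 , + 2
exit D  = + 0 , -[1+ 0 ]
exit UR = + 2 , + 2
exit DL = -[1+ 0 ] , + 0
entry R  = + 1 , + 0
entry L  = + 0 , + 2
entry U  = + 2 , + 2
entry D  = -[1+ 0 ] , -[1+ 0 ]
entry UR = + 2 , + 1
entry DL = -[1+ 0 ] , + 1

door : ∀ δ → Consecutive (exit δ) (entry δ) hexagon
door R  = _ ∷ _ ∷ _ ∷ _ ∷ _ ∷ [] , _ , refl
door L  = _ ∷ _ ∷ _ ∷ _ ∷ _ ∷ _ ∷ _ ∷ _ ∷ _ ∷ _ ∷ [] , _ , refl
door U  = _ ∷ _ ∷ _ ∷ [] , _ , refl
door D  = _ ∷ _ ∷ _ ∷ _ ∷ _ ∷ _ ∷ _ ∷ [] , _ , refl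
door UR = _ ∷ _ ∷ _ ∷ _ ∷ [] , _ , refl
door DL = _ ∷ _ ∷ _ ∷ _ ∷ _ ∷ _ ∷ _ ∷ _ ∷ _ ∷ [] , _ , refl

exit-to-neighbour : ∀ δ → exit δ ∼ (tileOrigin (direction δ) ⊕ entry (opposite δ))
exit-to-neighbour R  = d
exit-to-neighbour L  = u
exit-to-neighbour U  = u
exit-to-neighbour D  = d
exit-to-neighbour UR = ur
exit-to-neighbour DL = dl

neighbour-to-entry : ∀ δ → (tileOrigin (direction δ) ⊕ exit (opposite δ)) ∼ entry δ
neighbour-to-entry R  = u
neighbour-to-entry L  = d
neighbour-to-entry U  = d
neighbour-to-entry D  = u
neighbour-to-entry UR = dl
neighbour-to-entry DL = ur

exitDirection : Point → Maybe Direction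
exitDirection (+ 2 , + 1)           = just R
exitDirection (-[1+ 0 ] , + 1)      = just L
exitDirection (+ 1 , + 2)           = just U
exitDirection (+ 0 , -[1+ 0 ])      = just D
exitDirection (+ 2 , + 2)           = just UR
exitDirection (-[1+ 0 ] , + 0)      = just DL
exitDirection _                     = nothing

exitDirection-exit : ∀ δ → exitDirection (exit δ) ≡ just δ
exitDirection-exit R  = refl
exitDirection-exit L  = refl
exitDirection-exit U  = refl
exitDirection-exit D  = refl
exitDirection-exit UR = refl
exitDirection-exit DL = refl

exit-injective : ∀ {δ δ′} → exit δ ≡ exit δ′ → δ ≡ δ′
exit-injective {δ} {δ′} eq = just-injective
  (trans (sym (exitDirection-exit δ)) (trans (cong exitDirection eq) (exitDirection-exit δ′)))

_≟_ : (p q : Point) → Dec (p ≡ q)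
_≟_ = Product.≡-dec ℤ._≟_ ℤ._≟_

open import Data.List.Membership.DecPropositional _≟_ using (_∈?_)
open import Data.List.Relation.Unary.Unique.DecPropositional _≟_ using (unique?)

hexagon-unique : Unique hexagon
hexagon-unique = from-yes (unique? hexagon)

hexagon-transversal : ∀ {p q} → p ∈ hexagon → q ∈ hexagon → InSublattice (q ⊖ p) → p ≡ q
hexagon-transversal p∈ q∈ = All.lookup (All.lookup table p∈) q∈
  where
  sublattice? : ∀ p → Dec (InSublattice p)
  sublattice? (x , y) = (+ 2 ∣? x) ×-dec (+ 6 ∣? x + y)
  table : All (λ p → All (λ q → InSublattice (q ⊖ p) → p ≡ q) hexagon) hexagon
  table = from-yes (All.all? (λ p → All.all? (λ q →
            sublattice? (q ⊖ p) →-dec (p ≟ q)) hexagon) hexagon)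

InH2? : ∀ p → Dec (InH2 p)
InH2? (i , j) = ((- (+ 2) ℤ.<? i) ×-dec (i ℤ.≤? + 2)) ×-dec ((- (+ 2) ℤ.<? j) ×-dec (j ℤ.≤? + 2))
              ×-dec ((- (+ 2) ℤ.≤? i - j) ×-dec (i - j ℤ.<? + 2))

hexagon⊆H₂ : All InH2 hexagon
hexagon⊆H₂ = from-yes (All.all? InH2? hexagon)

H₂⊆hexagon : ∀ {p} → InH2 p → p ∈ hexagon
H₂⊆hexagon {x , y} h@((-2<x , x≤2) , (-2<y , y≤2) , _) =
  All.lookup (All.lookup table (window-complete -2<x x≤2)) (window-complete -2<y y≤2) h
  where
  window : List ℤ
  window = -[1+ 0 ] ∷ + 0 ∷ + 1 ∷ + 2 ∷ []
  window-complete : ∀ {x} → - (+ 2) ℤ.< x → x ℤ.≤ + 2 → x ∈ window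
  window-complete { -[1+ 0 ] }        _                     _ = here refl
  window-complete { -[1+ ℕ.suc _ ] } (ℤ.-<- (s≤s ()))      _
  window-complete {+ 0}               _                     _ = there (here refl)
  window-complete {+ 1}               _                     _ = there (there (here refl))
  window-complete {+ 2}               _                     _ = there (there (there (here refl)))
  window-complete {+ ℕ.suc (ℕ.suc (ℕ.suc _))} _ (ℤ.+≤+ (s≤s (s≤s ())))
  table : All (λ x → All (λ y → InH2 (x , y) → (x , y) ∈ hexagon) window) window
  table = from-yes (All.all? (λ x → All.all? (λ y →
            InH2? (x , y) →-dec ((x , y) ∈? hexagon)) window) window)

tiles-disjoint : ∀ {s t p q} → p ∈ hexagon → q ∈ hexagon →
                 tileOrigin s ⊕ p ≡ tileOrigin t ⊕ q → s ≡ t × p ≡ q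
tiles-disjoint {s} {t} {p} {q} p∈ q∈ eq = s≡t , p≡q
  where
  difference : tileOrigin (s ⊖ t) ≡ q ⊖ p
  difference = trans (tileOrigin-⊖ s t) (sym (⊕-≡⇒⊖-≡ (tileOrigin s) (tileOrigin t) p q eq))
  p≡q : p ≡ q
  p≡q = hexagon-transversal p∈ q∈ (subst InSublattice difference (tileOrigin-inSublattice (s ⊖ t)))
  s≡t : s ≡ t
  s≡t = tileOrigin-injective (⊕-cancelʳ p (trans eq (cong (tileOrigin t ⊕_) (sym p≡q))))

detour : Direction → List Point
detour δ = cut (door δ)

detour-↭ : ∀ δ → detour δ ↭ hexagon
detour-↭ δ = cut-↭ (door δ)

tileExit tileEntry : Point → Direction → Point
tileExit t δ = tileOrigin t ⊕ exit δ
tileEntry t δ = tileOrigin t ⊕ entry δ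

door-determines : ∀ {t t′ δ δ′} → tileExit t δ ≡ tileExit t′ δ′ → t ≡ t′ × δ ≡ δ′
door-determines {t} {t′} {δ} {δ′} eq =
  proj₁ disjoint , exit-injective (proj₂ disjoint)
  where
  disjoint : t ≡ t′ × exit δ ≡ exit δ′
  disjoint = tiles-disjoint (consecutive⇒∈ (door δ)) (consecutive⇒∈ (door δ′)) eq

tileOrigin-neighbour : ∀ t v x → tileOrigin (t ⊕ v) ⊕ x ≡ tileOrigin t ⊕ (tileOrigin v ⊕ x)
tileOrigin-neighbour t v x =
  trans (cong (_⊕ x) (tileOrigin-⊕ t v)) (⊕-assoc (tileOrigin t) (tileOrigin v) x)

-- Growing a tiled Hamiltonian cycle

InTiles : List Point → Point → Set
InTiles T p = ∃[ t ] ∃[ q ] t ∈ T × q ∈ hexagon × p ≡ tileOrigin t ⊕ q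

record TiledCycle (S T c : List Point) : Set where
  field
    tiles⊆shape : T ⊆ S
    long        : 3 ℕ.≤ length c
    unique      : Unique c
    chain       : Chain c
    closed      : Joinable c c
    covered     : ∀ {p} → p ∈ c → InTiles T p
    complete    : ∀ {t q} → t ∈ T → q ∈ hexagon → tileOrigin t ⊕ q ∈ c
    doors-open  : ∀ {t} → t ∈ T → ∀ δ → t ⊕ direction δ ∉ T →
                  Consecutive (tileExit t δ) (tileEntry t δ) c

singleTile : ∀ {S s} → s ∈ S → TiledCycle S (s ∷ []) (map (tileOrigin s ⊕_) hexagon)
singleTile {s = s} s∈S = record
  { tiles⊆shape = λ { (here refl) → s∈S }
  ; long        = s≤s (s≤s (s≤s z≤n))
  ; unique      = Unique.map⁺ (⊕-cancelˡ (tileOrigin s)) hexagon-unique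
  ; chain       = chain-translate (tileOrigin s) hexagon-chain
  ; closed      = λ { refl refl → translate-∼ (tileOrigin s) (hexagon-closed refl refl) }
  ; covered     = λ p∈ → let q , q∈ , eq = ∈-map⁻ (tileOrigin s ⊕_) p∈
                         in s , q , here refl , q∈ , eq
  ; complete    = λ { (here refl) q∈ → ∈-map⁺ (tileOrigin s ⊕_) q∈ }
  ; doors-open  = λ { (here refl) δ _ → consecutive-map (tileOrigin s ⊕_) (door δ) }
  }

module Splice {S T xs ys} t δ (I : TiledCycle S T (xs ++ tileExit t δ ∷ tileEntry t δ ∷ ys))
              (t∈T : t ∈ T) (s∉T : t ⊕ direction δ ∉ T) where

  open TiledCycle I

  s : Point
  s = t ⊕ direction δ

  path : List Point
  path = map (tileOrigin s ⊕_) (detour (opposite δ))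

  c′ : List Point
  c′ = xs ++ tileExit t δ ∷ path ++ tileEntry t δ ∷ ys

  path-in-tile : ∀ {v} → v ∈ path → ∃[ q ] q ∈ hexagon × v ≡ tileOrigin s ⊕ q
  path-in-tile v∈ = let q , q∈ , eq = ∈-map⁻ (tileOrigin s ⊕_) v∈ in
    q , ∈-resp-↭ (detour-↭ (opposite δ)) q∈ , eq

  path-disjoint : Disjoint path (xs ++ tileExit t δ ∷ tileEntry t δ ∷ ys)
  path-disjoint (v∈path , v∈c) =
    let q , q∈ , v≡ = path-in-tile v∈path
        t′ , q′ , t′∈T , q′∈ , v≡′ = covered v∈c
    in s∉T (subst (_∈ T) (sym (proj₁ (tiles-disjoint q∈ q′∈ (trans (sym v≡) v≡′)))) t′∈T)

  path-chain : Chain (tileExit t δ ∷ path)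
  path-chain = subst (tileExit t δ ∼_) (sym (tileOrigin-neighbour t (direction δ) (entry (opposite δ))))
                   (translate-∼ (tileOrigin t) (exit-to-neighbour δ))
           ∷ chain-translate (tileOrigin s) (chain-cut (door (opposite δ)) hexagon-chain hexagon-closed)

  path-joins : Joinable (tileExit t δ ∷ path) (tileEntry t δ ∷ ys)
  path-joins ex refl = subst (_∼ tileEntry t δ) (just-injective (trans (sym last-path) ex))
    (subst (_∼ tileEntry t δ) (sym (tileOrigin-neighbour t (direction δ) (exit (opposite δ))))
           (translate-∼ (tileOrigin t) (neighbour-to-entry δ)))
    where
    last-path : last path ≡ just (tileOrigin s ⊕ exit (opposite δ))
    last-path = trans (List.last-map (tileOrigin s ⊕_) (detour (opposite δ)))
                    (cong (Maybe.map (tileOrigin s ⊕_)) (last-cut (door (opposite δ))))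

  covered′ : ∀ {p} → p ∈ c′ → InTiles (s ∷ T) p
  covered′ p∈ = [ new , old ]′ (∈-splice⁻ xs p∈)
    where
    new : ∀ {p} → p ∈ path → InTiles (s ∷ T) p
    new p∈path = let q , q∈ , eq = path-in-tile p∈path in s , q , here refl , q∈ , eq
    old : ∀ {p} → p ∈ xs ++ tileExit t δ ∷ tileEntry t δ ∷ ys → InTiles (s ∷ T) p
    old p∈c = let t′ , q , t′∈T , q∈ , eq = covered p∈c in t′ , q , there t′∈T , q∈ , eq

  complete′ : ∀ {t′ q} → t′ ∈ s ∷ T → q ∈ hexagon → tileOrigin t′ ⊕ q ∈ c′
  complete′ (here refl) q∈ =
    ∈-splice⁺ˡ xs (∈-map⁺ (tileOrigin s ⊕_) (∈-resp-↭ (↭-sym (detour-↭ (opposite δ))) q∈))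
  complete′ (there t′∈T) q∈ = ∈-splice⁺ʳ xs {ds = path} (complete t′∈T q∈)

  doors-open′ : ∀ {t′} → t′ ∈ s ∷ T → ∀ δ′ → t′ ⊕ direction δ′ ∉ s ∷ T →
                Consecutive (tileExit t′ δ′) (tileEntry t′ δ′) c′
  doors-open′ (here refl) δ′ outside = consecutive-spliced xs
    (consecutive-map (tileOrigin s ⊕_) (consecutive-cut (door (opposite δ)) (door δ′) facing-away))
    where
    facing-away : exit δ′ ≢ exit (opposite δ)
    facing-away eq = outside (there (subst (_∈ T) (sym back-to-t) t∈T))
      where
      back-to-t : s ⊕ direction δ′ ≡ t
      back-to-t = trans (cong (λ δ″ → s ⊕ direction δ″) (exit-injective eq))
                        (⊕-direction-opposite t δ)
  doors-open′ {t′} (there t′∈T) δ′ outside =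
    consecutive-splice xs path (doors-open t′∈T δ′ (λ m → outside (there m))) other-door
    where
    other-door : tileExit t′ δ′ ≢ tileExit t δ
    other-door eq = outside (here (cong₂ (λ t″ δ″ → t″ ⊕ direction δ″) (proj₁ same) (proj₂ same)))
      where
      same : t′ ≡ t × δ′ ≡ δ
      same = door-determines eq

  tiledCycle : s ∈ S → TiledCycle S (s ∷ T) c′
  tiledCycle s∈S = record
    { tiles⊆shape = λ { (here refl) → s∈S ; (there m) → tiles⊆shape m }
    ; long        = ℕ.≤-trans long (length-splice xs path (tileEntry t δ ∷ ys))
    ; unique      = unique-splice xs path-unique unique path-disjoint
    ; chain       = chain-splice xs chain path-chain path-joins
    ; closed      = λ ex ey → closed (trans (sym last-splice) ex) (trans head-splice ey)
    ; covered     = covered′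
    ; complete    = complete′
    ; doors-open  = doors-open′
    }
    where
    path-unique : Unique path
    path-unique = Unique.map⁺ (⊕-cancelˡ (tileOrigin s))
                  (unique-resp-↭ (↭-sym (detour-↭ (opposite δ))) hexagon-unique)
    last-splice : last c′ ≡ last (xs ++ tileExit t δ ∷ tileEntry t δ ∷ ys)
    last-splice = trans (last-++ xs (path ++ tileEntry t δ ∷ ys))
                 (trans (last-++ (tileExit t δ ∷ path) ys) (sym (last-++ xs (tileEntry t δ ∷ ys))))
    head-splice : head (xs ++ tileExit t δ ∷ tileEntry t δ ∷ ys) ≡ head c′
    head-splice = head-++ xs (tileEntry t δ ∷ ys) (path ++ tileEntry t δ ∷ ys)

extend : ∀ {S T c t} → TiledCycle S T c → t ∈ T →
         ∀ δ → t ⊕ direction δ ∈ S → t ⊕ direction δ ∉ T →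
         ∃[ c′ ] TiledCycle S (t ⊕ direction δ ∷ T) c′
extend {t = t} I t∈T δ s∈S s∉T with TiledCycle.doors-open I t∈T δ s∉T
... | _ , _ , refl = _ , Splice.tiledCycle t δ I t∈T s∉T s∈S

TiledExtension : (S T : List Point) → (List Point → Set) → Set
TiledExtension S T P = ∃₂ λ T′ c′ → TiledCycle S T′ c′ × T ⊆ T′ × P T′

absorb : ∀ {S T c p q} → TiledCycle S T c → p ∈ T → p ∼ q → q ∈ S → TiledExtension S T (q ∈_)
absorb {T = T} {p = p} {q = q} I p∈T p∼q q∈S with q ∈? T
... | yes q∈T = _ , _ , I , ⊆-refl , q∈T
... | no q∉T with ∼⇒direction {p} {q} p∼q
...   | δ , refl with extend I p∈T δ q∈S q∉T
...     | _ , I′ = _ , _ , I′ , there , here refl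

grow-along : ∀ {S T c p w} → TiledCycle S T c → p ∈ T → Chain (p ∷ w) → All (_∈ S) w →
             TiledExtension S T (λ T′ → All (_∈ T′) w)
grow-along I p∈T [ _ ] [] = _ , _ , I , ⊆-refl , []
grow-along I p∈T (p∼q ∷ walk) (q∈S ∷ walk⊆S) with absorb I p∈T p∼q q∈S
... | _ , _ , I₁ , T⊆T₁ , q∈T₁ with grow-along I₁ q∈T₁ walk walk⊆S
...   | _ , _ , I′ , T₁⊆T′ , walk⊆T′ = _ , _ , I′ , ⊆-trans T⊆T₁ T₁⊆T′ , T₁⊆T′ q∈T₁ ∷ walk⊆T′

grow-over : ∀ {S T c s₀} → Connected S → s₀ ∈ S → TiledCycle S T c → s₀ ∈ T →
            ∀ xs → xs ⊆ S → TiledExtension S T (xs ⊆_)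
grow-over conn s₀∈S I s₀∈T [] _ = _ , _ , I , ⊆-refl , λ ()
grow-over conn s₀∈S I s₀∈T (x ∷ xs) x∷xs⊆S with conn s₀∈S (x∷xs⊆S (here refl))
... | [] , _ , _ , () , _
... | _ ∷ w , walk , _ ∷ w⊆S , hd , lt with just-injective hd
...   | refl with grow-along I s₀∈T walk w⊆S
...     | _ , _ , I₁ , T⊆T₁ , w⊆T₁ with grow-over conn s₀∈S I₁ (T⊆T₁ s₀∈T) xs (x∷xs⊆S ∘ there)
...       | _ , _ , I′ , T₁⊆T′ , xs⊆T′ = _ , _ , I′ , ⊆-trans T⊆T₁ T₁⊆T′ , x∷xs⊆T′
  where
  x∷xs⊆T′ : x ∷ xs ⊆ _
  x∷xs⊆T′ (here refl) = T₁⊆T′ (All.lookup (T⊆T₁ s₀∈T ∷ w⊆T₁) (∈-last lt))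
  x∷xs⊆T′ (there m)   = xs⊆T′ m

tiledCycle⇒hamiltonian : ∀ {S T c} → TiledCycle S T c → S ⊆ T → HamiltonianCycle (InΛC2 S) c
tiledCycle⇒hamiltonian {S} {T} {c} I S⊆T = long , unique , chain , closed , All.tabulate inΛ , complete′
  where
  open TiledCycle I
  inΛ : ∀ {p} → p ∈ c → InΛC2 S p
  inΛ p∈c with covered p∈c
  ... | (i , j) , q , t∈T , q∈ , refl =
    i , j , tiles⊆shape t∈T ,
    subst InH2 (sym ([m⊕n]⊖m≡n (tileOrigin (i , j)) q)) (All.lookup hexagon⊆H₂ q∈)
  complete′ : ∀ p → InΛC2 S p → p ∈ c
  complete′ p (i , j , ij∈S , h) =
    subst (_∈ c) (m⊕[n⊖m]≡n (tileOrigin (i , j)) p) (complete (S⊆T ij∈S) (H₂⊆hexagon h))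

lemma5 : (S : FiniteShape) →
    ∃[ c ] HamiltonianCycle (InΛC2 (FiniteShape.pts S)) c
lemma5 S with FiniteShape.nonempty S
... | s₀ , s₀∈S
  with grow-over (FiniteShape.connected S) s₀∈S (singleTile s₀∈S) (here refl) (FiniteShape.pts S) ⊆-refl
... | _ , c , I , _ , S⊆T = c , tiledCycle⇒hamiltonian I S⊆T
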